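{- Let $R$ be a monotone transit function on a non-empty finite set $V$ satisfying (uc): for all $x,y,u,v\in V$, if $R(x,y)\cap R(u,v)\neq\emptyset$ then there exist $p,q\in R(x,y)\cup R(u,v)$ with $R(x,y)\cup R(u,v)=R(p,q)$. Then $R$ satisfies (l2): for all $x,y,p,q,u,v\in V$, if $R(x,y)\between R(p,q)$, $R(p,q)\between R(u,v)$ and $R(x,y)\cap R(u,v)=\emptyset$, then $R(x,y)\cup R(p,q)\cup R(u,v)=R(s,t)$ for some $s\in R(x,y)\setminus R(p,q)$ and $t\in R(u,v)\setminus R(p,q)$.
   Context: A transit function on $V$ is a map $R:V\times V\to 2^V$ with $u\in R(u,v)$, $R(u,v)=R(v,u)$, $R(u,u)=\{u\}$ for all $u,v\in V$; it is monotone if $p,q\in R(u,v)$ implies $R(p,q)\subseteq R(u,v)$. Sets $A,B$ overlap, $A\between B$, if $A\cap B$, $A\setminus B$, $B\setminus A$ are all non-empty. -}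

module Defs where

open import Data.Nat using (ℕ)
open import Data.Fin using (Fin)
open import Data.Fin.Subset using (Subset; _∈_; _∉_; _⊆_; _∩_; _∪_; _─_; ⁅_⁆; Nonempty; Empty)
open import Data.Product using (_×_; ∃; ∃-syntax; _,_)
open import Relation.Binary.PropositionalEquality using (_≡_)

record IsTransit {n : ℕ} (R : Fin n → Fin n → Subset n) : Set where
  field
    extensive : ∀ u v → u ∈ R u v
    symmetric : ∀ u v → R u v ≡ R v u
    idempotent : ∀ u → R u u ≡ ⁅ u ⁆

IsMonotone : {n : ℕ} → (Fin n → Fin n → Subset n) → Set
IsMonotone R = ∀ u v p q → p ∈ R u v → q ∈ R u v → R p q ⊆ R u v

_≬_ : {n : ℕ} → Subset n → Subset n → Set
A ≬ B = Nonempty (A ∩ B) × Nonempty (A ─ B) × Nonempty (B ─ A)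

UC : {n : ℕ} → (Fin n → Fin n → Subset n) → Set
UC R = ∀ x y u v → Nonempty (R x y ∩ R u v) →
  ∃[ p ] ∃[ q ] (p ∈ (R x y ∪ R u v) × q ∈ (R x y ∪ R u v) × (R x y ∪ R u v ≡ R p q))

L2 : {n : ℕ} → (Fin n → Fin n → Subset n) → Set
L2 R = ∀ x y p q u v → R x y ≬ R p q → R p q ≬ R u v → Empty (R x y ∩ R u v) →
  ∃[ s ] ∃[ t ] (s ∈ (R x y ─ R p q) × t ∈ (R u v ─ R p q)
                 × (R x y ∪ R p q ∪ R u v ≡ R s t))

{-# OPTIONS --safe #-}
-- Let A ≬ B, B ≬ C with A, C disjoint. By (uc), B ∪ C = R(c,d), and then A ∪ B ∪ C = R(s,t)
-- with s, t in the union; also A ∪ B = R(a,b). If s, t both lay in B ∪ C, monotonicity would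
-- give R(s,t) ⊆ B ∪ C, missing a point of A ∖ B; likewise s, t cannot both lie in A ∪ B,
-- since R(s,t) contains a point of C ∖ B. So one endpoint is in A ∖ B, the other in C ∖ B.
module Submission where

open import Defs
open import Data.Nat using (ℕ; suc)
open import Data.Fin using (Fin)
open import Data.Fin.Subset using (Subset; _∈_; _∉_; _∪_; _∩_; _─_; Nonempty; Empty; inside; outside)
open import Data.Fin.Subset.Properties
  using (_∈?_; p⊆p∪q; q⊆p∪q; x∈p∪q⁺; x∈p∪q⁻; x∈p∩q⁺; x∈p∩q⁻; x∈p∧x∉q⇒x∈p─q; p─q⊆p)
open import Data.Vec using (_∷_)
open import Data.Vec.Base using (here; there)
open import Data.Product using (∃-syntax; _×_; _,_)
open import Data.Sum using (_⊎_; inj₁; inj₂)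
open import Function using (_∘_)
open import Relation.Nullary using (yes; no)
open import Relation.Nullary.Negation using (contradiction)
open import Relation.Binary.PropositionalEquality using (_≡_; sym; trans; cong; subst)

private
  variable
    n : ℕ
    x : Fin n
    p q : Subset n

x∈p─q⇒x∉q : ∀ (p q : Subset n) → x ∈ p ─ q → x ∉ q
x∈p─q⇒x∉q (inside ∷ p) (outside ∷ q) here = λ ()
x∈p─q⇒x∉q (_ ∷ p) (_ ∷ q) (there x∈p─q) (there x∈q) = x∈p─q⇒x∉q p q x∈p─q x∈q

x∈p∪q∧x∉q⇒x∈p : ∀ (p q : Subset n) → x ∈ p ∪ q → x ∉ q → x ∈ p
x∈p∪q∧x∉q⇒x∈p p q x∈p∪q x∉q with x∈p∪q⁻ p q x∈p∪q
... | inj₁ x∈p = x∈p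
... | inj₂ x∈q = contradiction x∈q x∉q

x∈p∪q∧x∉p⇒x∈q : ∀ (p q : Subset n) → x ∈ p ∪ q → x ∉ p → x ∈ q
x∈p∪q∧x∉p⇒x∈q p q x∈p∪q x∉p with x∈p∪q⁻ p q x∈p∪q
... | inj₁ x∈p = contradiction x∈p x∉p
... | inj₂ x∈q = x∈q

x∉p∧x∉q⇒x∉p∪q : ∀ (p q : Subset n) → x ∉ p → x ∉ q → x ∉ p ∪ q
x∉p∧x∉q⇒x∉p∪q p q x∉p x∉q x∈p∪q with x∈p∪q⁻ p q x∈p∪q
... | inj₁ x∈p = x∉p x∈p
... | inj₂ x∈q = x∉q x∈q

Empty[p∩q]∧x∈p⇒x∉q : Empty (p ∩ q) → x ∈ p → x ∉ q
Empty[p∩q]∧x∈p⇒x∉q p∩q≡∅ x∈p x∈q = p∩q≡∅ (_ , x∈p∩q⁺ (x∈p , x∈q))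

x∈p∪q∪r∧x∉q∪r⇒x∈p─q : ∀ (p q r : Subset n) → x ∈ p ∪ q ∪ r → x ∉ q ∪ r → x ∈ p ─ q
x∈p∪q∪r∧x∉q∪r⇒x∈p─q p q r x∈ x∉q∪r =
  x∈p∧x∉q⇒x∈p─q (x∈p∪q∧x∉q⇒x∈p p (q ∪ r) x∈ x∉q∪r) (x∉q∪r ∘ p⊆p∪q r)

x∈p∪q∪r∧x∉p∪q⇒x∈r─q : ∀ (p q r : Subset n) → x ∈ p ∪ q ∪ r → x ∉ p ∪ q → x ∈ r ─ q
x∈p∪q∪r∧x∉p∪q⇒x∈r─q {x = x} p q r x∈ x∉p∪q =
  x∈p∧x∉q⇒x∈p─q (x∈p∪q∧x∉p⇒x∈q q r (x∈p∪q∧x∉p⇒x∈q p (q ∪ r) x∈ x∉p) x∉q) x∉q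
  where
  x∉p : x ∉ p
  x∉p = x∉p∪q ∘ p⊆p∪q q
  x∉q : x ∉ q
  x∉q = x∉p∪q ∘ q⊆p∪q p q

endpoints-separated : ∀ (a b c : Subset n) {s t : Fin n} →
  s ∈ a ∪ b ∪ c → t ∈ a ∪ b ∪ c →
  s ∉ b ∪ c ⊎ t ∉ b ∪ c → s ∉ a ∪ b ⊎ t ∉ a ∪ b →
  (s ∈ a ─ b × t ∈ c ─ b) ⊎ (t ∈ a ─ b × s ∈ c ─ b)
endpoints-separated a b c s∈ t∈ (inj₁ s∉b∪c) (inj₁ s∉a∪b) =
  contradiction (p─q⊆p a b (x∈p∪q∪r∧x∉q∪r⇒x∈p─q a b c s∈ s∉b∪c)) (s∉a∪b ∘ p⊆p∪q b)
endpoints-separated a b c s∈ t∈ (inj₁ s∉b∪c) (inj₂ t∉a∪b) =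
  inj₁ (x∈p∪q∪r∧x∉q∪r⇒x∈p─q a b c s∈ s∉b∪c , x∈p∪q∪r∧x∉p∪q⇒x∈r─q a b c t∈ t∉a∪b)
endpoints-separated a b c s∈ t∈ (inj₂ t∉b∪c) (inj₁ s∉a∪b) =
  inj₂ (x∈p∪q∪r∧x∉q∪r⇒x∈p─q a b c t∈ t∉b∪c , x∈p∪q∪r∧x∉p∪q⇒x∈r─q a b c s∈ s∉a∪b)
endpoints-separated a b c s∈ t∈ (inj₂ t∉b∪c) (inj₂ t∉a∪b) =
  contradiction (p─q⊆p a b (x∈p∪q∪r∧x∉q∪r⇒x∈p─q a b c t∈ t∉b∪c)) (t∉a∪b ∘ p⊆p∪q b)

module _ (R : Fin n → Fin n → Subset n) where

  endpoint-outside : IsMonotone R → ∀ {S c d s t z} → S ≡ R c d →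
    z ∈ R s t → z ∉ S → s ∉ S ⊎ t ∉ S
  endpoint-outside mono {S} {c} {d} {s} {t} S≡Rcd z∈Rst z∉S with s ∈? S | t ∈? S
  ... | no s∉S  | _       = inj₁ s∉S
  ... | yes _   | no t∉S  = inj₂ t∉S
  ... | yes s∈S | yes t∈S =
    contradiction (mono c d s t (subst (s ∈_) S≡Rcd s∈S) (subst (t ∈_) S≡Rcd t∈S) z∈Rst)
                  (z∉S ∘ subst (_ ∈_) (sym S≡Rcd))

  uc-chain : UC R → ∀ {x y p q u v c d} → Nonempty (R x y ∩ R p q) → R p q ∪ R u v ≡ R c d →
    ∃[ s ] ∃[ t ] (s ∈ R x y ∪ R p q ∪ R u v × t ∈ R x y ∪ R p q ∪ R u v
                   × R x y ∪ R p q ∪ R u v ≡ R s t)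
  uc-chain uc {x} {y} {p} {q} {u} {v} {c} {d} (w , w∈A∩B) B∪C≡Rcd
    with x∈p∩q⁻ (R x y) (R p q) w∈A∩B
  ... | w∈A , w∈B
    with uc x y c d (w , x∈p∩q⁺ (w∈A , subst (w ∈_) B∪C≡Rcd (p⊆p∪q (R u v) w∈B)))
  ... | s , t , s∈ , t∈ , A∪Rcd≡Rst =
    s , t , subst (s ∈_) A∪Rcd≡A∪B∪C s∈ , subst (t ∈_) A∪Rcd≡A∪B∪C t∈ ,
    trans (sym A∪Rcd≡A∪B∪C) A∪Rcd≡Rst
    where
    A∪Rcd≡A∪B∪C : R x y ∪ R c d ≡ R x y ∪ R p q ∪ R u v
    A∪Rcd≡A∪B∪C = cong (R x y ∪_) (sym B∪C≡Rcd)

mainTheorem12 : (n : ℕ) (R : Fin (suc n) → Fin (suc n) → Subset (suc n)) →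
    IsTransit R → IsMonotone R → UC R → L2 R
mainTheorem12 n R transit mono uc x y p q u v
  (A∩B≢∅ , (z₁ , z₁∈A─B) , _) (B∩C≢∅ , _ , (z₂ , z₂∈C─B)) A∩C≡∅
  with uc x y p q A∩B≢∅ | uc p q u v B∩C≢∅
... | a , b , _ , _ , A∪B≡Rab | c , d , _ , _ , B∪C≡Rcd
  with uc-chain R uc A∩B≢∅ B∪C≡Rcd
... | s , t , s∈ , t∈ , A∪B∪C≡Rst
  with endpoints-separated A B C s∈ t∈
         (endpoint-outside R mono B∪C≡Rcd (inRst (inj₁ z₁∈A)) z₁∉B∪C)
         (endpoint-outside R mono A∪B≡Rab (inRst (inj₂ (q⊆p∪q B C z₂∈C))) z₂∉A∪B)
  where
  A B C : Subset (suc n)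
  A = R x y
  B = R p q
  C = R u v
  inRst : ∀ {z} → z ∈ A ⊎ z ∈ B ∪ C → z ∈ R s t
  inRst = subst (_ ∈_) A∪B∪C≡Rst ∘ x∈p∪q⁺
  z₁∈A : z₁ ∈ A
  z₁∈A = p─q⊆p A B z₁∈A─B
  z₂∈C : z₂ ∈ C
  z₂∈C = p─q⊆p C B z₂∈C─B
  z₁∉B∪C : z₁ ∉ B ∪ C
  z₁∉B∪C = x∉p∧x∉q⇒x∉p∪q B C (x∈p─q⇒x∉q A B z₁∈A─B) (Empty[p∩q]∧x∈p⇒x∉q A∩C≡∅ z₁∈A)
  z₂∉A∪B : z₂ ∉ A ∪ B
  z₂∉A∪B = x∉p∧x∉q⇒x∉p∪q A B (λ z₂∈A → Empty[p∩q]∧x∈p⇒x∉q A∩C≡∅ z₂∈A z₂∈C) (x∈p─q⇒x∉q C B z₂∈C─B)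
... | inj₁ (s∈A─B , t∈C─B) = s , t , s∈A─B , t∈C─B , A∪B∪C≡Rst
... | inj₂ (t∈A─B , s∈C─B) = t , s , t∈A─B , s∈C─B , trans A∪B∪C≡Rst (IsTransit.symmetric transit s t)
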